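{- Let $h \geq 2$. Let $X$ be a countably infinite set, and let $\mathcal{A}$ be a set of finite subsets of $X$. For every finite subset $S$ of $X$, let $g_{\mathcal{A},h}(S)$ be the number of $h$-tuples $(A_1,\ldots,A_h) \in \mathcal{A} \times \cdots \times \mathcal{A}$ such that $A_i \cap A_j = \emptyset$ for $1 \leq i < j \leq h$ and $S = \bigcup_{i=1}^h A_i$. Let $W$ be an infinite set of positive integers such that for every $n \in W$, one has $g_{\mathcal{A},h}(S) \geq 1$ for all but finitely many sets $S \in [X]^n$. Then for every integer $n$ there is a finite subset $S$ of $X$ with $g_{\mathcal{A},h}(S) \geq n$.
   Context: For a set $X$ and a nonnegative integer $k$, $[X]^k$ denotes the set of all subsets of $X$ of cardinality $k$. -}

module Defs where

open import Data.Nat using (ℕ; _<_; _≤_; _≥_)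
open import Data.Fin as Fin using (Fin)
open import Data.List using (List; length)
open import Data.List.Membership.Propositional using (_∈_; _∉_)
open import Data.List.Relation.Unary.All using (All)
open import Data.List.Relation.Unary.Linked using (Linked)
open import Data.List.Relation.Unary.Unique.Propositional using (Unique)
open import Data.Vec using (Vec; lookup)
open import Data.Product using (Σ; ∃; _×_)
open import Data.Empty using (⊥)
open import Function.Bundles using (_⇔_)

-- The countably infinite set X is taken to be ℕ.
-- A finite subset of ℕ is represented canonically by the strictly
-- increasing list of its elements (so equal sets are equal lists).
Canonical : List ℕ → Set
Canonical = Linked _<_

Family : Set₁
Family = Σ (List ℕ → Set) (λ 𝒜 → ∀ A → 𝒜 A → Canonical A)

Disjoint : List ℕ → List ℕ → Set
Disjoint A B = ∀ x → x ∈ A → x ∈ B → ⊥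

IsRep : (𝒜 : Family) (h : ℕ) (S : List ℕ) (t : Vec (List ℕ) h) → Set
IsRep 𝒜 h S t =
  (∀ i → Σ.proj₁ 𝒜 (lookup t i)) ×
  (∀ (i j : Fin h) → Fin.toℕ i < Fin.toℕ j → Disjoint (lookup t i) (lookup t j)) ×
  (∀ x → x ∈ S ⇔ ∃ (λ i → x ∈ lookup t i))
  where open Data.Product

g≥ : (𝒜 : Family) (h : ℕ) (S : List ℕ) (n : ℕ) → Set
g≥ 𝒜 h S n = ∃ λ (L : List (Vec (List ℕ) h)) →
  length L ≡ n × Unique L × All (IsRep 𝒜 h S) L
  where open import Relation.Binary.PropositionalEquality using (_≡_)

CofinitelyRepresented : (𝒜 : Family) (h : ℕ) (n : ℕ) → Set
CofinitelyRepresented 𝒜 h n = ∃ λ (E : List (List ℕ)) →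
  ∀ S → Canonical S → length S ≡ n → S ∉ E → g≥ 𝒜 h S 1
  where open import Relation.Binary.PropositionalEquality using (_≡_)

Infinite : (ℕ → Set) → Set
Infinite W = ∀ m → ∃ λ n → m ≤ n × W n

-- Fix n ∈ W with n ≥ 2N + 1. Every n-set outside the finite exceptional list E has a representation;
-- choose one and colour the set by its label word, the sequence of indices of the parts containing its
-- elements, in increasing order. By Ramsey's theorem, among the numbers exceeding all elements of E
-- there is a large set H all of whose n-subsets have the same label word ρ. So the l-th part of an
-- n-subset Y of H consists of the elements of Y at the positions where ρ is l, and every set occupying
-- the l-positions of some n-subset of H belongs to 𝒜.
--   If ρ takes two different values, take n elements of H far apart from each other. Every colouring of
-- them with the colour counts of ρ is realised class by class by n-subsets of H, hence is a
-- representation of their union; transposing the colour of one element with that of each of N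
-- differently coloured elements gives N distinct representations.
--   If ρ is constant, every n-subset of H and the empty set belong to 𝒜, and the same transpositions
-- split 2n elements of H into two n-subsets in N different ways.

module Submission where

open import Defs
open import Data.Nat using (ℕ; zero; suc; _+_; _*_; _≤_; _<_; _≥_; z≤n; s≤s; _≤?_; _<?_)
import Data.Nat as ℕ
open import Data.Nat.Properties hiding (_≟_)
open import Data.Fin using (Fin; toℕ; zero; suc)
open import Data.Fin.Properties using (toℕ-injective) renaming (_≟_ to _≟ᶠ_)
import Data.Fin.Properties as Finₚ
open import Data.List
  using ( List; []; _∷_; [_]; _++_; length; map; filter; take; upTo; applyUpTo; replicate; concat; allFin
        ; cartesianProductWith)
open import Data.List.Properties
  using ( ≡-dec; length-map; length-take; length-++; length-replicate; length-upTo; length-applyUpTo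
        ; map-applyUpTo; map-∘; filter-++; filter-all; filter-none)
open import Data.List.Extrema.Nat using (max; xs≤max)
open import Data.List.Membership.Propositional using (_∈_; _∉_; find)
open import Data.List.Membership.Propositional.Properties
open import Data.List.Membership.DecPropositional ℕ._≟_ using (_∈?_)
open import Data.List.Membership.DecPropositional (≡-dec ℕ._≟_) using () renaming (_∈?_ to _∈ᴸ?_)
open import Data.List.Relation.Unary.All as All using (All; []; _∷_)
import Data.List.Relation.Unary.All.Properties as All
open import Data.List.Relation.Unary.AllPairs as AllPairs using (AllPairs; []; _∷_)
import Data.List.Relation.Unary.AllPairs.Properties as AllPairs
open import Data.List.Relation.Unary.Any using (here; there)
import Data.List.Relation.Unary.Linked as Linked
open import Data.List.Relation.Unary.Linked.Properties using (AllPairs⇒Linked; Linked⇒AllPairs)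
open import Data.List.Relation.Binary.Sublist.Propositional
  using (_⊆_; []; _∷_; _∷ʳ_; minimum; ⊆-refl; ⊆-trans; ⊆-antisym)
import Data.List.Relation.Binary.Sublist.Propositional.Properties as Sublist
open import Data.Vec using (Vec; lookup; tabulate)
import Data.Vec as Vec
open import Data.Vec.Properties using (lookup∘tabulate)
open import Data.Product using (∃; ∃₂; _×_; _,_; proj₁; proj₂)
open import Data.Sum as Sum using (_⊎_; inj₁; inj₂)
open import Data.Empty using (⊥-elim)
open import Function using (_∘_; id)
open import Function.Bundles using (mk⇔; Equivalence)
open import Relation.Nullary using (¬_; Dec; yes; no; ¬?; contradiction; _×-dec_)
import Relation.Unary
open import Relation.Unary.Properties using (∁?)
open import Relation.Binary.Definitions using (DecidableEquality; tri<; tri≈; tri>)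
open import Relation.Binary.PropositionalEquality hiding ([_])

private variable
  A B : Set

AllPairs-resp-⊆ : ∀ {R : A → A → Set} {xs ys : List A} → xs ⊆ ys → AllPairs R ys → AllPairs R xs
AllPairs-resp-⊆ [] [] = []
AllPairs-resp-⊆ (y ∷ʳ τ) (_ ∷ ps) = AllPairs-resp-⊆ τ ps
AllPairs-resp-⊆ (refl ∷ τ) (p ∷ ps) = Sublist.All-resp-⊆ τ p ∷ AllPairs-resp-⊆ τ ps

AllPairs-map-≢ : ∀ {P : A → Set} (f : A → B) → (∀ {x y} → P x → P y → x ≢ y → f x ≢ f y) →
                 ∀ {xs} → All P xs → AllPairs _≢_ xs → AllPairs _≢_ (map f xs)
AllPairs-map-≢ f f-inj [] [] = []
AllPairs-map-≢ f f-inj (px ∷ pxs) (x≢ ∷ distinct) =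
  All.map⁺ (All.zipWith (λ (py , x≢y) → f-inj px py x≢y) (pxs , x≢)) ∷ AllPairs-map-≢ f f-inj pxs distinct

length-filter-∁ : ∀ {P : A → Set} (P? : Relation.Unary.Decidable P) xs →
                  length (filter P? xs) + length (filter (∁? P?) xs) ≡ length xs
length-filter-∁ P? [] = refl
length-filter-∁ P? (x ∷ xs) with P? x
... | yes _ = cong suc (length-filter-∁ P? xs)
... | no _ = trans (+-suc _ _) (cong suc (length-filter-∁ P? xs))

replicate-∈ : ∀ {k} {x : A} → 0 < k → x ∈ replicate k x
replicate-∈ {k = suc _} _ = here refl

words : List A → ℕ → List (List A)
words xs zero = [ [] ]
words xs (suc k) = cartesianProductWith _∷_ xs (words xs k)

∈-words : ∀ {xs} (w : List A) → All (_∈ xs) w → w ∈ words xs (length w)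
∈-words [] [] = here refl
∈-words (c ∷ w) (c∈ ∷ w∈) = ∈-cartesianProductWith⁺ _∷_ c∈ (∈-words w w∈)

lookupOr : A → List A → ℕ → A
lookupOr d [] _ = d
lookupOr d (x ∷ xs) zero = x
lookupOr d (x ∷ xs) (suc i) = lookupOr d xs i

applyUpTo-lookupOr : (d : A) (xs : List A) → applyUpTo (lookupOr d xs) (length xs) ≡ xs
applyUpTo-lookupOr d [] = refl
applyUpTo-lookupOr d (x ∷ xs) = cong (x ∷_) (applyUpTo-lookupOr d xs)

map-lookupOr-upTo : (d : A) (xs : List A) → map (lookupOr d xs) (upTo (length xs)) ≡ xs
map-lookupOr-upTo d xs = trans (map-applyUpTo id (lookupOr d xs) (length xs)) (applyUpTo-lookupOr d xs)

lookupOr-surjective : ∀ (d : A) xs {x} → x ∈ xs → ∃ λ i → i ∈ upTo (length xs) × lookupOr d xs i ≡ x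
lookupOr-surjective d xs x∈ with ∈-map⁻ (lookupOr d xs) (subst (_ ∈_) (sym (map-lookupOr-upTo d xs)) x∈)
... | i , i∈ , x≡ = i , i∈ , sym x≡

lookupOr-∈ : ∀ (d : A) xs {i} → i < length xs → lookupOr d xs i ∈ xs
lookupOr-∈ d (x ∷ xs) {zero} _ = here refl
lookupOr-∈ d (x ∷ xs) {suc i} (s≤s i<) = there (lookupOr-∈ d xs i<)

Sorted : List ℕ → Set
Sorted = AllPairs _<_

upTo-sorted : ∀ n → Sorted (upTo n)
upTo-sorted n = AllPairs.applyUpTo⁺₁ id n (λ i<j _ → i<j)

∈-tail : ∀ {y z ys} → y < z → z ∈ y ∷ ys → z ∈ ys
∈-tail y<z (here refl) = contradiction y<z (<-irrefl refl)
∈-tail _ (there z∈ys) = z∈ys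

sorted-⊆ : ∀ {xs ys} → Sorted xs → Sorted ys → All (_∈ ys) xs → xs ⊆ ys
sorted-⊆ {[]} _ _ _ = minimum _
sorted-⊆ {x ∷ xs} {[]} _ _ (() ∷ _)
sorted-⊆ {x ∷ xs} {y ∷ ys} (x< ∷ sxs) (y< ∷ sys) (here refl ∷ xs∈) =
  refl ∷ sorted-⊆ sxs sys (All.zipWith (λ (x<z , z∈) → ∈-tail x<z z∈) (x< , xs∈))
sorted-⊆ {x ∷ xs} {y ∷ ys} (x< ∷ sxs) (y< ∷ sys) (there x∈ys ∷ xs∈) =
  y ∷ʳ sorted-⊆ (x< ∷ sxs) sys
    (x∈ys ∷ All.zipWith (λ (x<z , z∈) → ∈-tail (<-trans (All.lookup y< x∈ys) x<z) z∈) (x< , xs∈))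

sorted-≡ : ∀ {xs ys} → Sorted xs → Sorted ys →
           (∀ {z} → z ∈ xs → z ∈ ys) → (∀ {z} → z ∈ ys → z ∈ xs) → xs ≡ ys
sorted-≡ sxs sys to from =
  ⊆-antisym (sorted-⊆ sxs sys (All.tabulate to)) (sorted-⊆ sys sxs (All.tabulate from))

lookupOr-< : ∀ d {xs} → Sorted xs → ∀ {i j} → i < j → j < length xs → lookupOr d xs i < lookupOr d xs j
lookupOr-< d {x ∷ xs} (x< ∷ _) {zero} {suc j} _ (s≤s j<) = All.lookup x< (lookupOr-∈ d xs j<)
lookupOr-< d {x ∷ xs} (_ ∷ sxs) {suc i} {suc j} (s≤s i<j) (s≤s j<) = lookupOr-< d sxs i<j j<

lookupOr-injective : ∀ d {xs} → Sorted xs → ∀ {i j} → i < length xs → j < length xs →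
                     lookupOr d xs i ≡ lookupOr d xs j → i ≡ j
lookupOr-injective d sxs {i} {j} i< j< eq with <-cmp i j
... | tri< i<j _ _ = contradiction eq (<⇒≢ (lookupOr-< d sxs i<j j<))
... | tri≈ _ i≡j _ = i≡j
... | tri> _ _ j<i = contradiction (sym eq) (<⇒≢ (lookupOr-< d sxs j<i i<))

map-lookupOr-sorted : ∀ d {xs is} → Sorted xs → Sorted is → All (_< length xs) is →
                      Sorted (map (lookupOr d xs) is)
map-lookupOr-sorted d sxs [] [] = []
map-lookupOr-sorted d sxs (i< ∷ sis) (_ ∷ is<) =
  All.map⁺ (All.zipWith (λ (i<j , j<) → lookupOr-< d sxs i<j j<) (i< , is<)) ∷ map-lookupOr-sorted d sxs sis is<

map-lookupOr-⊆ : ∀ d {xs is} → Sorted xs → Sorted is → All (_< length xs) is → map (lookupOr d xs) is ⊆ xs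
map-lookupOr-⊆ d sxs sis is< =
  sorted-⊆ (map-lookupOr-sorted d sxs sis is<) sxs (All.map⁺ (All.map (lookupOr-∈ d _) is<))

-- Consecutive values differ by k + 1, which leaves room for the k filler indices of `fill`.
spread : ℕ → ℕ → ℕ
spread k r = suc k * suc r

spread-≥ : ∀ {k r} → k ≤ spread k r
spread-≥ {k} {r} = ≤-trans (n≤1+n k) (m≤m*n (suc k) (suc r))

spread-≤ : ∀ {k r} → r < k → spread k r ≤ suc k * k
spread-≤ {k} = *-monoʳ-≤ (suc k)

spread-gap : ∀ {k r r'} → r < r' → suc (spread k r) + k ≤ spread k r'
spread-gap {k} {r} {r'} r<r' = begin
  suc (spread k r) + k   ≡⟨ +-suc (spread k r) k ⟨
  spread k r + suc k     ≡⟨ +-comm (spread k r) (suc k) ⟩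
  suc k + spread k r     ≡⟨ *-suc (suc k) (suc r) ⟨
  suc k * suc (suc r)    ≤⟨ *-monoʳ-≤ (suc k) (s≤s r<r') ⟩
  spread k r'            ∎
  where open ≤-Reasoning

spread-monoʳ-< : ∀ {k r r'} → r < r' → spread k r < spread k r'
spread-monoʳ-< {k} r<r' = ≤-trans (m≤m+n _ k) (spread-gap r<r')

update : (ℕ → A) → ℕ → A → ℕ → A
update f p v r with r ℕ.≟ p
... | yes _ = v
... | no _ = f r

update-≡ : ∀ (f : ℕ → A) p v → update f p v p ≡ v
update-≡ f p v with p ℕ.≟ p
... | yes _ = refl
... | no p≢p = contradiction refl p≢p

update-≢ : ∀ (f : ℕ → A) p v {r} → r ≢ p → update f p v r ≡ f r
update-≢ f p v {r} r≢p with r ℕ.≟ p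
... | yes r≡p = contradiction r≡p r≢p
... | no _ = refl

update-at : ∀ (f : ℕ → A) p q → update f p (f q) q ≡ f q
update-at f p q with q ℕ.≟ p
... | yes _ = refl
... | no _ = refl

map-update-∉ : ∀ (f : ℕ → A) p v {rs} → All (_≢ p) rs → map (update f p v) rs ≡ map f rs
map-update-∉ f p v [] = refl
map-update-∉ f p v (r≢p ∷ rs≢p) = cong₂ _∷_ (update-≢ f p v r≢p) (map-update-∉ f p v rs≢p)

transpose : (ℕ → A) → ℕ → ℕ → ℕ → A
transpose f s t = update (update f s (f t)) t (f s)

pigeonhole : ∀ {C : Set} (_≟_ : DecidableEquality C) (cs : List C) m (f : B → C) xs →
             All (λ x → f x ∈ cs) xs → length cs * m < length xs →
             ∃ λ c → c ∈ cs × m ≤ length (filter ((_≟ c) ∘ f) xs)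
pigeonhole _≟_ [] m f [] [] ()
pigeonhole _≟_ [] m f (x ∷ xs) (() ∷ _) _
pigeonhole _≟_ (d ∷ cs) m f xs fxs∈ big with m ≤? length (filter ((_≟ d) ∘ f) xs)
... | yes m≤ = d , here refl , m≤
... | no m≰ =
  let c , c∈ , m≤ = pigeonhole _≟_ cs m f rest rest∈ rest-big
  in c , there c∈ , ≤-trans m≤ (Sublist.length-mono-≤ (rest-class⊆ c))
  where
  rest = filter (∁? ((_≟ d) ∘ f)) xs
  rest-class⊆ : ∀ c → filter ((_≟ c) ∘ f) rest ⊆ filter ((_≟ c) ∘ f) xs
  rest-class⊆ c = Sublist.filter⁺ _ _ (λ { refl → id }) (Sublist.filter-⊆ _ xs)
  rest∈ : All (λ x → f x ∈ cs) rest
  rest∈ = All.zipWith (λ { (here fx≡d , fx≢d) → contradiction fx≡d fx≢d ; (there fx∈ , _) → fx∈ })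
            (All.filter⁺ _ fxs∈ , All.all-filter (∁? ((_≟ d) ∘ f)) xs)
  rest-big : length cs * m < length rest
  rest-big = +-cancelˡ-< m _ _ (<-≤-trans big (≤-trans (≤-reflexive (sym (length-filter-∁ ((_≟ d) ∘ f) xs)))
               (+-monoˡ-≤ (length rest) (<⇒≤ (≰⇒> m≰)))))

module Ramsey {A C : Set} (_≟_ : DecidableEquality C) (palette : List C) where

  Monochromatic : (List A → C) → ℕ → List A → C → Set
  Monochromatic χ k H c = ∀ Y → Y ⊆ H → length Y ≡ k → χ Y ≡ c

  data Prehomogeneous (χ : List A → C) (k : ℕ) : List (A × C) → Set where
    [] : Prehomogeneous χ k []
    _∷_ : ∀ {x c ps} → Monochromatic (χ ∘ (x ∷_)) k (map proj₁ ps) c →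
          Prehomogeneous χ k ps → Prehomogeneous χ k ((x , c) ∷ ps)

  prehomogeneous-resp-⊆ : ∀ {χ : List A → C} {k ps qs} → ps ⊆ qs → Prehomogeneous χ k qs → Prehomogeneous χ k ps
  prehomogeneous-resp-⊆ [] [] = []
  prehomogeneous-resp-⊆ (_ ∷ʳ τ) (_ ∷ pre) = prehomogeneous-resp-⊆ τ pre
  prehomogeneous-resp-⊆ (refl ∷ τ) (mono ∷ pre) =
    (λ Y Y⊆ len → mono Y (⊆-trans Y⊆ (Sublist.map⁺ proj₁ τ)) len) ∷ prehomogeneous-resp-⊆ τ pre

  monochromatic-suc : ∀ {χ : List A → C} {k c ps} → Prehomogeneous χ k ps → All ((_≡ c) ∘ proj₂) ps →
                      Monochromatic χ (suc k) (map proj₁ ps) c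
  monochromatic-suc [] [] [] [] ()
  monochromatic-suc (_ ∷ pre) (_ ∷ cs) Y (_ ∷ʳ Y⊆) len = monochromatic-suc pre cs Y Y⊆ len
  monochromatic-suc (mono ∷ _) (refl ∷ _) (_ ∷ Y) (refl ∷ Y⊆) len = mono Y Y⊆ (suc-injective len)

  ramsey : ∀ k m → ∃ λ M → ∀ (L : List A) → M ≤ length L → (χ : List A → C) →
           (∀ Y → length Y ≡ k → χ Y ∈ palette) →
           ∃₂ λ H c → H ⊆ L × m ≤ length H × c ∈ palette × Monochromatic χ k H c
  ramsey zero m = m , λ L m≤ χ χ∈ → L , χ [] , ⊆-refl , m≤ , χ∈ [] refl , λ { [] _ _ → refl }
  ramsey (suc k) m = bound (suc (length palette * m)) , monochromatic
    where
    -- Each point x of a prehomogeneous list fixes the colour of all (k+1)-sets starting at x and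
    -- continuing in the list; among |palette| · m + 1 such points, m share their colour.
    bound : ℕ → ℕ
    bound zero = 0
    bound (suc j) = suc (proj₁ (ramsey k (bound j)))

    prehomogeneous : ∀ j L → bound j ≤ length L → ∀ (χ : List A → C) →
                     (∀ Y → length Y ≡ suc k → χ Y ∈ palette) →
                     ∃ λ ps → j ≤ length ps × map proj₁ ps ⊆ L × All ((_∈ palette) ∘ proj₂) ps ×
                              Prehomogeneous χ k ps
    prehomogeneous zero L _ χ χ∈ = [] , z≤n , minimum _ , [] , []
    prehomogeneous (suc j) (x ∷ L) (s≤s j≤) χ χ∈ =
      let H , c , H⊆ , bound≤ , c∈ , mono =
            proj₂ (ramsey k (bound j)) L j≤ (χ ∘ (x ∷_)) (λ Y → χ∈ (x ∷ Y) ∘ cong suc)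
          ps , j≤ps , ps⊆ , ps∈ , pre = prehomogeneous j H bound≤ χ χ∈
      in (x , c) ∷ ps , s≤s j≤ps , refl ∷ ⊆-trans ps⊆ H⊆ , c∈ ∷ ps∈ ,
         (λ Y Y⊆ len → mono Y (⊆-trans Y⊆ ps⊆) len) ∷ pre

    monochromatic : ∀ L → bound (suc (length palette * m)) ≤ length L → (χ : List A → C) →
                    (∀ Y → length Y ≡ suc k → χ Y ∈ palette) →
                    ∃₂ λ H c → H ⊆ L × m ≤ length H × c ∈ palette × Monochromatic χ (suc k) H c
    monochromatic L bound≤ χ χ∈ =
      let ps , big , ps⊆ , ps∈ , pre = prehomogeneous _ L bound≤ χ χ∈
          c , c∈ , m≤ = pigeonhole _≟_ palette m proj₂ ps ps∈ big
          selected = filter ((_≟ c) ∘ proj₂) ps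
      in map proj₁ selected , c ,
         ⊆-trans (Sublist.map⁺ proj₁ (Sublist.filter-⊆ _ ps)) ps⊆ ,
         subst (m ≤_) (sym (length-map proj₁ selected)) m≤ , c∈ ,
         monochromatic-suc (prehomogeneous-resp-⊆ (Sublist.filter-⊆ _ ps) pre) (All.all-filter _ ps)

module Colouring {L : Set} (_≟_ : DecidableEquality L) where

  occurrences : L → List L → ℕ
  occurrences l cs = length (filter (_≟ l) cs)

  occurrences-++ : ∀ l xs ys → occurrences l (xs ++ ys) ≡ occurrences l xs + occurrences l ys
  occurrences-++ l xs ys = trans (cong length (filter-++ (_≟ l) xs ys)) (length-++ (filter (_≟ l) xs))

  select : List L → L → List A → List A
  select [] l ys = []
  select (c ∷ cs) l [] = []
  select (c ∷ cs) l (y ∷ ys) with c ≟ l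
  ... | yes _ = y ∷ select cs l ys
  ... | no _ = select cs l ys

  select-accept : ∀ {l c cs} {y : A} {ys} → c ≡ l → select (c ∷ cs) l (y ∷ ys) ≡ y ∷ select cs l ys
  select-accept {l = l} {c = c} c≡l with c ≟ l
  ... | yes _ = refl
  ... | no c≢l = contradiction c≡l c≢l

  select-reject : ∀ {l c cs} {y : A} {ys} → c ≢ l → select (c ∷ cs) l (y ∷ ys) ≡ select cs l ys
  select-reject {l = l} {c = c} c≢l with c ≟ l
  ... | yes c≡l = contradiction c≡l c≢l
  ... | no _ = refl

  select-map : ∀ l (f : A → L) ys → select (map f ys) l ys ≡ filter ((_≟ l) ∘ f) ys
  select-map l f [] = refl
  select-map l f (y ∷ ys) with f y ≟ l
  ... | yes _ = cong (y ∷_) (select-map l f ys)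
  ... | no _ = select-map l f ys

  select-natural : ∀ l (g : A → B) cs ys → select cs l (map g ys) ≡ map g (select cs l ys)
  select-natural l g [] ys = refl
  select-natural l g (c ∷ cs) [] = refl
  select-natural l g (c ∷ cs) (y ∷ ys) with c ≟ l
  ... | yes _ = cong (g y ∷_) (select-natural l g cs ys)
  ... | no _ = select-natural l g cs ys

  select-constant : ∀ {a} cs (ys : List A) → All (_≡ a) cs → length cs ≡ length ys → select cs a ys ≡ ys
  select-constant [] [] _ _ = refl
  select-constant (c ∷ cs) (y ∷ ys) (c≡a ∷ cs≡a) eq =
    trans (select-accept c≡a) (cong (y ∷_) (select-constant cs ys cs≡a (suc-injective eq)))

  select-absent : ∀ {l} cs (ys : List A) → All (_≢ l) cs → select cs l ys ≡ []
  select-absent [] ys _ = refl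
  select-absent (c ∷ cs) [] _ = refl
  select-absent (c ∷ cs) (y ∷ ys) (c≢l ∷ cs≢l) = trans (select-reject c≢l) (select-absent cs ys cs≢l)

  length-select : ∀ l cs (ys : List A) → length cs ≡ length ys → length (select cs l ys) ≡ occurrences l cs
  length-select l [] [] _ = refl
  length-select l (c ∷ cs) (y ∷ ys) eq with c ≟ l
  ... | yes _ = cong suc (length-select l cs ys (suc-injective eq))
  ... | no _ = length-select l cs ys (suc-injective eq)

  length-filter-≟ : ∀ l (f : A → L) xs → length (filter ((_≟ l) ∘ f) xs) ≡ occurrences l (map f xs)
  length-filter-≟ l f xs =
    trans (cong length (sym (select-map l f xs))) (length-select l (map f xs) xs (length-map f xs))

  occurrences-replicate-≡ : ∀ l k → occurrences l (replicate k l) ≡ k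
  occurrences-replicate-≡ l k =
    trans (cong length (filter-all (_≟ l) (All.replicate⁺ k refl))) (length-replicate k)

  occurrences-replicate-≢ : ∀ {c l} k → c ≢ l → occurrences l (replicate k c) ≡ 0
  occurrences-replicate-≢ {l = l} k c≢l = cong length (filter-none (_≟ l) (All.replicate⁺ k c≢l))

  occurrences-two-blocks : ∀ {a a'} k l → a' ≢ a →
    occurrences l (replicate k a ++ replicate k a') ≡ 0 ⊎ occurrences l (replicate k a ++ replicate k a') ≡ k
  occurrences-two-blocks {a} {a'} k l a'≢a with a ≟ l | a' ≟ l
  ... | yes refl | yes a'≡a = contradiction a'≡a a'≢a
  ... | yes refl | no a'≢l = inj₂ (trans (occurrences-++ a (replicate k a) _)
          (trans (cong₂ _+_ (occurrences-replicate-≡ a k) (occurrences-replicate-≢ k a'≢l)) (+-identityʳ k)))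
  ... | no a≢l | yes refl = inj₂ (trans (occurrences-++ a' (replicate k a) _)
          (cong₂ _+_ (occurrences-replicate-≢ k a≢l) (occurrences-replicate-≡ a' k)))
  ... | no a≢l | no a'≢l = inj₁ (trans (occurrences-++ l (replicate k a) _)
          (cong₂ _+_ (occurrences-replicate-≢ k a≢l) (occurrences-replicate-≢ k a'≢l)))

  -- A list of indices with the entries of β at the l-positions of cs; every other entry is
  -- the successor of the previous one (c at the start). A missing β-entry is filled in the same way,
  -- which does not happen when length β ≡ occurrences l cs.
  fill : L → List L → List ℕ → ℕ → List ℕ
  fill l [] β c = []
  fill l (x ∷ cs) β c with x ≟ l
  fill l (x ∷ cs) (b ∷ β) c | yes _ = b ∷ fill l cs β (suc b)
  fill l (x ∷ cs) [] c | yes _ = c ∷ fill l cs [] (suc c)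
  ... | no _ = c ∷ fill l cs β (suc c)

  length-fill : ∀ l cs β c → length (fill l cs β c) ≡ length cs
  length-fill l [] β c = refl
  length-fill l (x ∷ cs) β c with x ≟ l
  length-fill l (x ∷ cs) (b ∷ β) c | yes _ = cong suc (length-fill l cs β (suc b))
  length-fill l (x ∷ cs) [] c | yes _ = cong suc (length-fill l cs [] (suc c))
  ... | no _ = cong suc (length-fill l cs β (suc c))

  select-fill : ∀ l cs β c → length β ≡ occurrences l cs → select cs l (fill l cs β c) ≡ β
  select-fill l [] [] c _ = refl
  select-fill l (x ∷ cs) β c eq with x ≟ l
  select-fill l (x ∷ cs) (b ∷ β) c eq | yes x≡l =
    trans (select-accept x≡l) (cong (b ∷_) (select-fill l cs β (suc b) (suc-injective eq)))
  select-fill l (x ∷ cs) [] c () | yes _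
  ... | no x≢l = trans (select-reject x≢l) (select-fill l cs β (suc c) eq)

  private
    shorten : ∀ a k {b} → suc a + suc k ≤ b → suc a + k ≤ b
    shorten a k = ≤-trans (+-monoʳ-≤ (suc a) (n≤1+n k))

    widen : ∀ {a} b k → a ≤ suc b + k → a ≤ b + suc k
    widen b k le = ≤-trans le (≤-reflexive (sym (+-suc b k)))

  fill-sorted : ∀ l cs β c → All (λ b → c + length cs ≤ b) β → AllPairs (λ a b → suc a + length cs ≤ b) β →
                All (c ≤_) (fill l cs β c) × Sorted (fill l cs β c)
  fill-sorted l [] β c _ _ = [] , []
  fill-sorted l (x ∷ cs) β c β≥ gaps with x ≟ l
  fill-sorted l (x ∷ cs) (b ∷ β) c (b≥ ∷ β≥) (gap ∷ gaps) | yes _ =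
    let k = length cs
        rest≥ , sorted =
          fill-sorted l cs β (suc b) (All.map (shorten b k) gap) (AllPairs.map (λ {a} → shorten a k) gaps)
        c≤b = ≤-trans (m≤m+n c _) b≥
    in c≤b ∷ All.map (≤-trans c≤b ∘ <⇒≤) rest≥ , rest≥ ∷ sorted
  fill-sorted l (x ∷ cs) [] c _ _ | yes _ =
    let rest≥ , sorted = fill-sorted l cs [] (suc c) [] [] in ≤-refl ∷ All.map <⇒≤ rest≥ , rest≥ ∷ sorted
  ... | no _ =
    let k = length cs
        rest≥ , sorted = fill-sorted l cs β (suc c) (All.map (≤-trans (≤-reflexive (sym (+-suc c k)))) β≥)
                           (AllPairs.map (λ {a} → shorten a k) gaps)
    in ≤-refl ∷ All.map <⇒≤ rest≥ , rest≥ ∷ sorted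

  fill-bounded : ∀ l cs β c B → c ≤ B → All (_≤ B) β → All (_≤ B + length cs) (fill l cs β c)
  fill-bounded l [] β c B _ _ = []
  fill-bounded l (x ∷ cs) β c B c≤B β≤B with x ≟ l
  fill-bounded l (x ∷ cs) (b ∷ β) c B c≤B (b≤B ∷ β≤B) | yes _ =
    ≤-trans b≤B (m≤m+n B _) ∷
    All.map (widen B (length cs)) (fill-bounded l cs β (suc b) (suc B) (s≤s b≤B) (All.map m≤n⇒m≤1+n β≤B))
  fill-bounded l (x ∷ cs) [] c B c≤B _ | yes _ =
    ≤-trans c≤B (m≤m+n B _) ∷ All.map (widen B (length cs)) (fill-bounded l cs [] (suc c) (suc B) (s≤s c≤B) [])
  ... | no _ =
    ≤-trans c≤B (m≤m+n B _) ∷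
    All.map (widen B (length cs)) (fill-bounded l cs β (suc c) (suc B) (s≤s c≤B) (All.map m≤n⇒m≤1+n β≤B))

  occurrences-update : ∀ (τ : ℕ → L) p v l {rs} → AllPairs _≢_ rs → p ∈ rs →
    occurrences l (map (update τ p v) rs) + occurrences l [ τ p ] ≡ occurrences l (map τ rs) + occurrences l [ v ]
  occurrences-update τ p v l {p ∷ rs} (p∉rs ∷ _) (here refl) = begin
    occurrences l (update τ p v p ∷ map (update τ p v) rs) + occurrences l [ τ p ]
      ≡⟨ cong (_+ occurrences l [ τ p ]) (occurrences-++ l [ update τ p v p ] _) ⟩
    (occurrences l [ update τ p v p ] + occurrences l (map (update τ p v) rs)) + occurrences l [ τ p ]
      ≡⟨ cong₂ (λ w ws → (occurrences l [ w ] + occurrences l ws) + occurrences l [ τ p ])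
               (update-≡ τ p v) (map-update-∉ τ p v (All.map (_∘ sym) p∉rs)) ⟩
    (occurrences l [ v ] + occurrences l (map τ rs)) + occurrences l [ τ p ]
      ≡⟨ swap-outer (occurrences l [ v ]) _ _ ⟩
    (occurrences l [ τ p ] + occurrences l (map τ rs)) + occurrences l [ v ]
      ≡⟨ cong (_+ occurrences l [ v ]) (occurrences-++ l [ τ p ] _) ⟨
    occurrences l (τ p ∷ map τ rs) + occurrences l [ v ] ∎
    where
    open ≡-Reasoning
    swap-outer : ∀ a b c → a + b + c ≡ c + b + a
    swap-outer a b c = trans (+-comm (a + b) c) (trans (cong (c +_) (+-comm a b)) (sym (+-assoc c b a)))
  occurrences-update τ p v l {r ∷ rs} (r∉rs ∷ unique) (there p∈rs) = begin
    occurrences l (update τ p v r ∷ map (update τ p v) rs) + occurrences l [ τ p ]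
      ≡⟨ cong (_+ occurrences l [ τ p ]) (occurrences-++ l [ update τ p v r ] _) ⟩
    (occurrences l [ update τ p v r ] + occurrences l (map (update τ p v) rs)) + occurrences l [ τ p ]
      ≡⟨ +-assoc (occurrences l [ update τ p v r ]) _ _ ⟩
    occurrences l [ update τ p v r ] + (occurrences l (map (update τ p v) rs) + occurrences l [ τ p ])
      ≡⟨ cong₂ (λ w n → occurrences l [ w ] + n) (update-≢ τ p v r≢p) (occurrences-update τ p v l unique p∈rs) ⟩
    occurrences l [ τ r ] + (occurrences l (map τ rs) + occurrences l [ v ])
      ≡⟨ +-assoc (occurrences l [ τ r ]) _ _ ⟨
    (occurrences l [ τ r ] + occurrences l (map τ rs)) + occurrences l [ v ]
      ≡⟨ cong (_+ occurrences l [ v ]) (occurrences-++ l [ τ r ] _) ⟨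
    occurrences l (τ r ∷ map τ rs) + occurrences l [ v ] ∎
    where
    open ≡-Reasoning
    r≢p = All.lookup r∉rs p∈rs

  occurrences-transpose : ∀ (τ : ℕ → L) s t l {rs} → AllPairs _≢_ rs → s ∈ rs → t ∈ rs →
                          occurrences l (map (transpose τ s t) rs) ≡ occurrences l (map τ rs)
  occurrences-transpose τ s t l {rs} unique s∈ t∈ = +-cancelʳ-≡ _ _ _ (begin
    occurrences l (map (transpose τ s t) rs) + occurrences l [ τ t ]
      ≡⟨ cong (λ w → occurrences l (map (transpose τ s t) rs) + occurrences l [ w ]) (update-at τ s t) ⟨
    occurrences l (map (transpose τ s t) rs) + occurrences l [ update τ s (τ t) t ]
      ≡⟨ occurrences-update (update τ s (τ t)) t (τ s) l unique t∈ ⟩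
    occurrences l (map (update τ s (τ t)) rs) + occurrences l [ τ s ]
      ≡⟨ occurrences-update τ s (τ t) l unique s∈ ⟩
    occurrences l (map τ rs) + occurrences l [ τ t ] ∎)
    where open ≡-Reasoning

  widely-different : ∀ (κ : ℕ → L) {rs r₀ r₁} N → r₀ ∈ rs → r₁ ∈ rs → κ r₀ ≢ κ r₁ → N + suc N ≤ length rs →
                     ∃ λ s → s ∈ rs × N ≤ length (filter (∁? ((_≟ κ s) ∘ κ)) rs)
  -- If fewer than N elements differ in colour from r₀, then more than N share its colour, and these
  -- all differ from r₁.
  widely-different κ {rs} {r₀} {r₁} N r₀∈ r₁∈ κr₀≢κr₁ big with N ≤? length (filter (∁? ((_≟ κ r₀) ∘ κ)) rs)
  ... | yes N≤ = r₀ , r₀∈ , N≤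
  ... | no N≰ = r₁ , r₁∈ , ≤-trans N≤same (Sublist.length-mono-≤ same⊆differs)
    where
    same⇒differs : ∀ {t t'} → t ≡ t' → κ t ≡ κ r₀ → ¬ (κ t' ≡ κ r₁)
    same⇒differs refl κt≡κr₀ κt≡κr₁ = κr₀≢κr₁ (trans (sym κt≡κr₀) κt≡κr₁)
    same⊆differs : filter ((_≟ κ r₀) ∘ κ) rs ⊆ filter (∁? ((_≟ κ r₁) ∘ κ)) rs
    same⊆differs = Sublist.filter⁺ ((_≟ κ r₀) ∘ κ) (∁? ((_≟ κ r₁) ∘ κ)) same⇒differs (⊆-refl {x = rs})
    N≤same : N ≤ length (filter ((_≟ κ r₀) ∘ κ) rs)
    N≤same = <⇒≤ (+-cancelʳ-≤ _ _ _ (begin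
      suc N + N                   ≡⟨ +-comm (suc N) N ⟩
      N + suc N                   ≤⟨ big ⟩
      length rs                   ≡⟨ length-filter-∁ ((_≟ κ r₀) ∘ κ) rs ⟨
      length (filter ((_≟ κ r₀) ∘ κ) rs) + length (filter (∁? ((_≟ κ r₀) ∘ κ)) rs)
                                  ≤⟨ +-monoʳ-≤ _ (<⇒≤ (≰⇒> N≰)) ⟩
      length (filter ((_≟ κ r₀) ∘ κ) rs) + N ∎))
      where open ≤-Reasoning

module Representations {h : ℕ} (𝒜 : Family) where

  open Colouring (_≟ᶠ_ {h})

  InjectiveOn : (ℕ → ℕ) → List ℕ → Set
  InjectiveOn ψ rs = ∀ {r r'} → r ∈ rs → r' ∈ rs → ψ r ≡ ψ r' → r ≡ r'

  class : (ℕ → ℕ) → (ℕ → Fin h) → List ℕ → Fin h → List ℕ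
  class ψ τ rs l = map ψ (filter ((_≟ᶠ l) ∘ τ) rs)

  classes : (ℕ → ℕ) → (ℕ → Fin h) → List ℕ → Vec (List ℕ) h
  classes ψ τ rs = tabulate (class ψ τ rs)

  ∈-classes⁻ : ∀ {ψ τ rs l x} → x ∈ lookup (classes ψ τ rs) l → ∃ λ r → r ∈ rs × x ≡ ψ r × τ r ≡ l
  ∈-classes⁻ {ψ} {τ} {rs} {l} x∈ =
    ∈-map∘filter⁻ ψ ((_≟ᶠ l) ∘ τ) (subst (_ ∈_) (lookup∘tabulate (class ψ τ rs) l) x∈)

  ∈-classes⁺ : ∀ {ψ τ rs r} → r ∈ rs → ψ r ∈ lookup (classes ψ τ rs) (τ r)
  ∈-classes⁺ {ψ} {τ} {rs} {r} r∈ =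
    subst (_ ∈_) (sym (lookup∘tabulate (class ψ τ rs) (τ r)))
      (∈-map∘filter⁺ ψ ((_≟ᶠ τ r) ∘ τ) (r , r∈ , refl , refl))

  classes-represent : ∀ {ψ τ rs} → InjectiveOn ψ rs → (∀ l → proj₁ 𝒜 (class ψ τ rs l)) →
                      IsRep 𝒜 h (map ψ rs) (classes ψ τ rs)
  classes-represent {ψ} {τ} {rs} ψ-inj classes∈𝒜 = in𝒜 , disjoint , λ x → mk⇔ covered inside
    where
    in𝒜 : ∀ l → proj₁ 𝒜 (lookup (classes ψ τ rs) l)
    in𝒜 l = subst (proj₁ 𝒜) (sym (lookup∘tabulate (class ψ τ rs) l)) (classes∈𝒜 l)
    disjoint : ∀ i j → toℕ i < toℕ j → Disjoint (lookup (classes ψ τ rs) i) (lookup (classes ψ τ rs) j)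
    disjoint i j i<j x x∈i x∈j with ∈-classes⁻ x∈i | ∈-classes⁻ x∈j
    ... | r , r∈ , x≡ψr , τr≡i | r' , r'∈ , x≡ψr' , τr'≡j with ψ-inj r∈ r'∈ (trans (sym x≡ψr) x≡ψr')
    ... | refl = <-irrefl (cong toℕ (trans (sym τr≡i) τr'≡j)) i<j
    covered : ∀ {x} → x ∈ map ψ rs → ∃ λ i → x ∈ lookup (classes ψ τ rs) i
    covered x∈ with ∈-map⁻ ψ x∈
    ... | r , r∈ , refl = τ r , ∈-classes⁺ r∈
    inside : ∀ {x} → (∃ λ i → x ∈ lookup (classes ψ τ rs) i) → x ∈ map ψ rs
    inside (i , x∈) with ∈-classes⁻ x∈
    ... | r , r∈ , refl , _ = ∈-map⁺ ψ r∈

  transpose-classes-distinct : ∀ {ψ} (κ : ℕ → Fin h) {rs} → InjectiveOn ψ rs →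
                               ∀ {s a b} → a ∈ rs → κ a ≢ κ s → a ≢ b →
                               classes ψ (transpose κ s a) rs ≢ classes ψ (transpose κ s b) rs
  -- ψ a lies in the (κ s)-class of the first tuple, while a keeps its colour κ a in the second one.
  transpose-classes-distinct {ψ} κ {rs} ψ-inj {s} {a} {b} a∈ κa≢κs a≢b same
    with ∈-classes⁻ (subst (λ T → ψ a ∈ lookup T (κ s)) same ψa∈)
    where
    ψa∈ : ψ a ∈ lookup (classes ψ (transpose κ s a) rs) (κ s)
    ψa∈ = subst (λ c → ψ a ∈ lookup (classes ψ (transpose κ s a) rs) c) (update-≡ _ a (κ s)) (∈-classes⁺ a∈)
  ... | r , r∈ , ψa≡ψr , τr≡κs with ψ-inj a∈ r∈ ψa≡ψr
  ... | refl = κa≢κs (trans (sym (trans (update-≢ _ b (κ s) a≢b) (update-≢ κ s (κ b) a≢s))) τr≡κs)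
    where
    a≢s : a ≢ s
    a≢s refl = κa≢κs refl

  g≥-≤ : ∀ {S M N} → N ≤ M → g≥ 𝒜 h S M → g≥ 𝒜 h S N
  g≥-≤ {N = N} N≤M (reps , refl , distinct , represent) =
    take N reps , trans (length-take N reps) (m≤n⇒m⊓n≡m N≤M) , AllPairs.take⁺ N distinct , All.take⁺ N represent

  transpositions-g≥ : ∀ ψ (κ : ℕ → Fin h) {rs r₀ r₁} N → Sorted rs → InjectiveOn ψ rs → Sorted (map ψ rs) →
    (∀ τ → (∀ l → occurrences l (map τ rs) ≡ occurrences l (map κ rs)) → ∀ l → proj₁ 𝒜 (class ψ τ rs l)) →
    r₀ ∈ rs → r₁ ∈ rs → κ r₀ ≢ κ r₁ → N + suc N ≤ length rs →
    ∃ λ S → Canonical S × g≥ 𝒜 h S N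
  transpositions-g≥ ψ κ {rs} N rs-sorted ψ-inj ψrs-sorted realise r₀∈ r₁∈ κr₀≢κr₁ big
    with widely-different κ N r₀∈ r₁∈ κr₀≢κr₁ big
  ... | s , s∈ , N≤ =
    map ψ rs , AllPairs⇒Linked ψrs-sorted ,
    g≥-≤ N≤ (map rep others , length-map rep others , reps-distinct , All.map⁺ (All.map represents others-ok))
    where
    distinct : AllPairs _≢_ rs
    distinct = AllPairs.map <⇒≢ rs-sorted
    others = filter (∁? ((_≟ᶠ κ s) ∘ κ)) rs
    others-ok : All (λ t → t ∈ rs × κ t ≢ κ s) others
    others-ok = All.tabulate (∈-filter⁻ (∁? ((_≟ᶠ κ s) ∘ κ)))
    rep : ℕ → Vec (List ℕ) h
    rep t = classes ψ (transpose κ s t) rs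
    reps-distinct : AllPairs _≢_ (map rep others)
    reps-distinct = AllPairs-map-≢ rep (λ (a∈ , κa≢κs) _ → transpose-classes-distinct κ ψ-inj a∈ κa≢κs) others-ok
      (AllPairs.filter⁺ _ distinct)
    represents : ∀ {t} → t ∈ rs × κ t ≢ κ s → IsRep 𝒜 h (map ψ rs) (rep t)
    represents {t} (t∈ , _) =
      classes-represent ψ-inj (realise (transpose κ s t) (λ l → occurrences-transpose κ s t l distinct s∈ t∈))

  pattern-g≥ : ∀ ψ (π : List (Fin h)) {c₀ c₁} N → c₀ ∈ π → c₁ ∈ π → c₀ ≢ c₁ → N + suc N ≤ length π →
    InjectiveOn ψ (upTo (length π)) → Sorted (map ψ (upTo (length π))) →
    (∀ τ → (∀ l → occurrences l (map τ (upTo (length π))) ≡ occurrences l π) →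
           ∀ l → proj₁ 𝒜 (class ψ τ (upTo (length π)) l)) →
    ∃ λ S → Canonical S × g≥ 𝒜 h S N
  pattern-g≥ ψ π {c₀} {c₁} N c₀∈ c₁∈ c₀≢c₁ big ψ-inj sorted realise
    with lookupOr-surjective c₀ π c₀∈ | lookupOr-surjective c₀ π c₁∈
  ... | r₀ , r₀∈ , κr₀≡c₀ | r₁ , r₁∈ , κr₁≡c₁ =
    transpositions-g≥ ψ (lookupOr c₀ π) N (upTo-sorted _) ψ-inj sorted
      (λ τ same → realise τ (λ l → trans (same l) (cong (occurrences l) (map-lookupOr-upTo c₀ π))))
      r₀∈ r₁∈ (λ same → c₀≢c₁ (trans (sym κr₀≡c₀) (trans same κr₁≡c₁)))
      (subst (N + suc N ≤_) (sym (length-upTo _)) big)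

module Homogeneous {h : ℕ} (𝒜 : Family) {H : List ℕ} (H-sorted : Sorted H) (ρ : List (Fin h))
  (parts : ∀ Y → Y ⊆ H → length Y ≡ length ρ → ∀ l → proj₁ 𝒜 (Colouring.select _≟ᶠ_ ρ l Y)) where

  open Colouring (_≟ᶠ_ {h})
  open Representations {h} 𝒜

  k : ℕ
  k = length ρ

  at : ℕ → ℕ
  at = lookupOr 0 H

  index-parts : ∀ {I} → Sorted I → All (_< length H) I → length I ≡ k → ∀ l → proj₁ 𝒜 (map at (select ρ l I))
  index-parts {I} I-sorted I<H I-length l =
    subst (proj₁ 𝒜) (select-natural l at ρ I)
      (parts (map at I) (map-lookupOr-⊆ 0 H-sorted I-sorted I<H) (trans (length-map at I) I-length) l)

  at-injective : ∀ m → m ≤ length H → InjectiveOn at (upTo m)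
  at-injective m m≤H i∈ j∈ =
    lookupOr-injective 0 H-sorted (<-≤-trans (∈-upTo⁻ i∈) m≤H) (<-≤-trans (∈-upTo⁻ j∈) m≤H)

  module Spread (H-big : suc k * k + k < length H) where

    spread<H : ∀ {r} → r < k → spread k r < length H
    spread<H r<k = ≤-<-trans (≤-trans (spread-≤ r<k) (m≤m+n _ k)) H-big

    spread-injective : InjectiveOn (at ∘ spread k) (upTo k)
    spread-injective r∈ r'∈ same = suc-injective (*-cancelˡ-≡ _ _ (suc k)
      (lookupOr-injective 0 H-sorted (spread<H (∈-upTo⁻ r∈)) (spread<H (∈-upTo⁻ r'∈)) same))

    spread-sorted : Sorted (map (at ∘ spread k) (upTo k))
    spread-sorted = subst Sorted (sym (map-∘ (upTo k)))
      (map-lookupOr-sorted 0 H-sorted (AllPairs.map⁺ (AllPairs.map (spread-monoʳ-< {k}) (upTo-sorted k)))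
        (All.map⁺ (All.tabulate (spread<H ∘ ∈-upTo⁻))))

    spread-class∈𝒜 : ∀ τ → (∀ l → occurrences l (map τ (upTo k)) ≡ occurrences l ρ) →
                     ∀ l → proj₁ 𝒜 (class (at ∘ spread k) τ (upTo k) l)
    spread-class∈𝒜 τ same l =
      subst (proj₁ 𝒜) (trans (cong (map at) (select-fill l ρ β 0 β-length)) (sym (map-∘ C)))
        (index-parts (proj₂ I-sorted) I<H (length-fill l ρ β 0) l)
      where
      C = filter ((_≟ᶠ l) ∘ τ) (upTo k)
      C⊆ = Sublist.filter-⊆ ((_≟ᶠ l) ∘ τ) (upTo k)
      β = map (spread k) C
      I = fill l ρ β 0
      β-length : length β ≡ occurrences l ρ
      β-length = trans (length-map (spread k) C) (trans (length-filter-≟ l τ (upTo k)) (same l))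
      I-sorted = fill-sorted l ρ β 0 (All.map⁺ (All.tabulate (λ _ → spread-≥)))
        (AllPairs.map⁺ (AllPairs.map spread-gap (AllPairs-resp-⊆ C⊆ (upTo-sorted k))))
      I<H : All (_< length H) I
      I<H = All.map (λ i≤ → ≤-<-trans i≤ H-big)
        (fill-bounded l ρ β 0 (suc k * k) z≤n
          (All.map⁺ (All.tabulate (spread-≤ ∘ ∈-upTo⁻ ∘ Sublist.Any-resp-⊆ C⊆))))

  non-constant-pattern-g≥ : ∀ N {c₀ c₁} → c₀ ∈ ρ → c₁ ∈ ρ → c₀ ≢ c₁ → suc k * k + k < length H →
                            N + suc N ≤ k → ∃ λ S → Canonical S × g≥ 𝒜 h S N
  non-constant-pattern-g≥ N c₀∈ c₁∈ c₀≢c₁ H-big N-small =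
    pattern-g≥ (at ∘ spread k) ρ N c₀∈ c₁∈ c₀≢c₁ N-small spread-injective spread-sorted spread-class∈𝒜
    where open Spread H-big

  module Constant {a a'} (ρ≡a : All (_≡ a) ρ) (a'≢a : a' ≢ a) (k≤H : k ≤ length H) where

    subset∈𝒜 : ∀ {Y} → Y ⊆ H → length Y ≡ k → proj₁ 𝒜 Y
    subset∈𝒜 {Y} Y⊆H Y-length =
      subst (proj₁ 𝒜) (select-constant ρ Y ρ≡a (sym Y-length)) (parts Y Y⊆H Y-length a)

    empty∈𝒜 : proj₁ 𝒜 []
    empty∈𝒜 = subst (proj₁ 𝒜) (select-absent ρ (take k H) ρ≢a')
      (parts (take k H) (Sublist.take-⊆ k H) (trans (length-take k H) (m≤n⇒m⊓n≡m k≤H)) a')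
      where ρ≢a' = All.map (λ c≡a c≡a' → a'≢a (trans (sym c≡a') c≡a)) ρ≡a

    class∈𝒜 : ∀ {C} → Sorted C → All (_< length H) C → length C ≡ 0 ⊎ length C ≡ k → proj₁ 𝒜 (map at C)
    class∈𝒜 {[]} _ _ _ = empty∈𝒜
    class∈𝒜 {_ ∷ _} _ _ (inj₁ ())
    class∈𝒜 {C} C-sorted C<H (inj₂ C-length) =
      subset∈𝒜 (map-lookupOr-⊆ 0 H-sorted C-sorted C<H) (trans (length-map at C) C-length)

  constant-pattern-g≥ : ∀ N {a a'} → All (_≡ a) ρ → a' ≢ a → k + k ≤ length H →
                        N + suc N ≤ k → ∃ λ S → Canonical S × g≥ 𝒜 h S N
  constant-pattern-g≥ N {a} {a'} ρ≡a a'≢a H-big N-small =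
    pattern-g≥ at π N (∈-++⁺ˡ (replicate-∈ k>0)) (∈-++⁺ʳ (replicate k a) (replicate-∈ k>0))
      (a'≢a ∘ sym) (≤-trans N-small (≤-trans (m≤m+n k k) (≤-reflexive (sym length-π))))
      (at-injective (length π) π≤H) (map-lookupOr-sorted 0 H-sorted (upTo-sorted _) R<H) realise
    where
    open Constant ρ≡a a'≢a (≤-trans (m≤m+n k k) H-big)
    π = replicate k a ++ replicate k a'

    k>0 : 0 < k
    k>0 = ≤-trans (s≤s z≤n) (≤-trans (m≤n+m (suc N) N) N-small)

    length-π : length π ≡ k + k
    length-π = trans (length-++ (replicate k a)) (cong₂ _+_ (length-replicate k) (length-replicate k))

    π≤H : length π ≤ length H
    π≤H = subst (_≤ length H) (sym length-π) H-big

    R<H : All (_< length H) (upTo (length π))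
    R<H = All.tabulate (λ i∈ → <-≤-trans (∈-upTo⁻ i∈) π≤H)

    realise : ∀ τ → (∀ l → occurrences l (map τ (upTo (length π))) ≡ occurrences l π) →
              ∀ l → proj₁ 𝒜 (class at τ (upTo (length π)) l)
    realise τ same l = class∈𝒜 (AllPairs.filter⁺ P? (upTo-sorted (length π))) (All.filter⁺ P? R<H)
      (Sum.map (trans C-length) (trans C-length) (occurrences-two-blocks k l a'≢a))
      where
      P? = (_≟ᶠ l) ∘ τ
      C-length = trans (length-filter-≟ l τ (upTo (length π))) (same l)

  g≥-exists : ∀ N {a a'} → a ∈ ρ → a' ≢ a → suc k * k + k < length H →
              N + suc N ≤ k → ∃ λ S → Canonical S × g≥ 𝒜 h S N
  g≥-exists N {a} a∈ρ a'≢a H-big N-small with All.all? (_≟ᶠ a) ρ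
  ... | yes ρ≡a = constant-pattern-g≥ N ρ≡a a'≢a (<⇒≤ (≤-<-trans (+-monoˡ-≤ k (m≤m+n k (k * k))) H-big)) N-small
  ... | no ρ≢a with find (All.¬All⇒Any¬ (_≟ᶠ a) ρ ρ≢a)
  ...   | c , c∈ρ , c≢a = non-constant-pattern-g≥ N a∈ρ c∈ρ (c≢a ∘ sym) H-big N-small

module Cofinite (h' : ℕ) (𝒜 : Family) (n : ℕ) (E : List (List ℕ))
  (represented : ∀ S → Canonical S → length S ≡ n → S ∉ E → g≥ 𝒜 (suc (suc h')) S 1) where

  h : ℕ
  h = suc (suc h')

  open Colouring (_≟ᶠ_ {h})
  open Representations {h} 𝒜

  Admissible : List ℕ → Set
  Admissible S = Canonical S × length S ≡ n × S ∉ E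

  admissible? : ∀ S → Dec (Admissible S)
  admissible? S = Linked.linked? _<?_ S ×-dec length S ℕ.≟ n ×-dec ¬? (S ∈ᴸ? E)

  representative : ∀ {S} → g≥ 𝒜 h S 1 → ∃ (IsRep 𝒜 h S)
  representative ([] , () , _)
  representative (t ∷ _ , _ , _ , t-rep ∷ _) = t , t-rep

  -- chosenRep and label return junk values on non-admissible sets and on points in no part.
  chosenRep : List ℕ → Vec (List ℕ) h
  chosenRep S with admissible? S
  ... | yes (canonical , size , fresh) = proj₁ (representative (represented S canonical size fresh))
  ... | no _ = Vec.replicate h []

  chosenRep-isRep : ∀ {S} → Admissible S → IsRep 𝒜 h S (chosenRep S)
  chosenRep-isRep {S} adm with admissible? S
  ... | yes (canonical , size , fresh) = proj₂ (representative (represented S canonical size fresh))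
  ... | no ¬adm = contradiction adm ¬adm

  label : List ℕ → ℕ → Fin h
  label S x with Finₚ.any? (λ i → x ∈? lookup (chosenRep S) i)
  ... | yes (i , _) = i
  ... | no _ = zero

  label-correct : ∀ {S x} i → Admissible S → x ∈ lookup (chosenRep S) i → label S x ≡ i
  label-correct {S} {x} i adm x∈i with Finₚ.any? (λ i → x ∈? lookup (chosenRep S) i)
  ... | no none = contradiction (i , x∈i) none
  ... | yes (j , x∈j) with <-cmp (toℕ j) (toℕ i)
  ...   | tri< j<i _ _ = ⊥-elim (proj₁ (proj₂ (chosenRep-isRep adm)) j i j<i x x∈j x∈i)
  ...   | tri≈ _ j≡i _ = toℕ-injective j≡i
  ...   | tri> _ _ i<j = ⊥-elim (proj₁ (proj₂ (chosenRep-isRep adm)) i j i<j x x∈i x∈j)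

  part-≡ : ∀ {S} l → Admissible S → lookup (chosenRep S) l ≡ filter ((_≟ᶠ l) ∘ label S) S
  part-≡ {S} l adm@(canonical , _) =
    sorted-≡ part-sorted (AllPairs.filter⁺ _ (Linked⇒AllPairs <-trans canonical)) to from
    where
    S-rep = chosenRep-isRep adm
    part-sorted = Linked⇒AllPairs <-trans (proj₂ 𝒜 _ (proj₁ S-rep l))
    to : ∀ {x} → x ∈ lookup (chosenRep S) l → x ∈ filter ((_≟ᶠ l) ∘ label S) S
    to x∈l =
      ∈-filter⁺ ((_≟ᶠ l) ∘ label S) (Equivalence.from (proj₂ (proj₂ S-rep) _) (l , x∈l)) (label-correct l adm x∈l)
    from : ∀ {x} → x ∈ filter ((_≟ᶠ l) ∘ label S) S → x ∈ lookup (chosenRep S) l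
    from {x} x∈ with ∈-filter⁻ ((_≟ᶠ l) ∘ label S) x∈
    ... | x∈S , refl with Equivalence.to (proj₂ (proj₂ S-rep) x) x∈S
    ...   | j , x∈j = subst (λ i → x ∈ lookup (chosenRep S) i) (sym (label-correct j adm x∈j)) x∈j

  labels : List ℕ → List (Fin h)
  labels S = map (label S) S

  select-labels∈𝒜 : ∀ {S} → Admissible S → ∀ l → proj₁ 𝒜 (select (labels S) l S)
  select-labels∈𝒜 {S} adm l =
    subst (proj₁ 𝒜) (trans (part-≡ l adm) (sym (select-map l (label S) S))) (proj₁ (chosenRep-isRep adm) l)

  other : Fin h → Fin h
  other zero = suc zero
  other (suc _) = zero

  other-≢ : ∀ a → other a ≢ a
  other-≢ zero ()
  other-≢ (suc _) ()

  bound : ℕ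
  bound = suc (max 0 (concat E))

  module R = Ramsey {A = ℕ} (≡-dec _≟ᶠ_) (words (allFin h) n)

  -- Room for n spread-out elements of H together with the fillers of `fill`.
  size : ℕ
  size = suc (suc n * n + n)

  L : List ℕ
  L = applyUpTo (bound +_) (proj₁ (R.ramsey n size))

  L-sorted : Sorted L
  L-sorted = AllPairs.applyUpTo⁺₁ (bound +_) _ (λ i<j _ → +-monoʳ-< bound i<j)

  admissible : ∀ {Y} → 0 < n → Y ⊆ L → length Y ≡ n → Admissible Y
  admissible {[]} n>0 _ Y-length = contradiction (subst (0 <_) (sym Y-length) n>0) (λ ())
  admissible {y ∷ Y} n>0 Y⊆L Y-length = AllPairs⇒Linked (AllPairs-resp-⊆ Y⊆L L-sorted) , Y-length , fresh
    where
    fresh : y ∷ Y ∉ E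
    fresh Y∈E with ∈-applyUpTo⁻ (bound +_) (Sublist.Any-resp-⊆ Y⊆L (here refl))
    ... | i , _ , refl =
      contradiction (All.lookup (xs≤max 0 (concat E)) (∈-concat⁺′ (here refl) Y∈E)) (<⇒≱ (m≤m+n bound i))

  labels∈words : ∀ Y → length Y ≡ n → labels Y ∈ words (allFin h) n
  labels∈words Y Y-length =
    subst (λ k → labels Y ∈ words (allFin h) k) (trans (length-map (label Y) Y) Y-length)
      (∈-words (labels Y) (All.tabulate (λ _ → ∈-allFin _)))

  monochromatic-length : ∀ {H ρ} → n ≤ length H → R.Monochromatic labels n H ρ → length ρ ≡ n
  monochromatic-length {H} n≤H monochromatic =
    trans (cong length (sym (monochromatic (take n H) (Sublist.take-⊆ n H) take-length)))
      (trans (length-map _ (take n H)) take-length)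
    where take-length = trans (length-take n H) (m≤n⇒m⊓n≡m n≤H)

  monochromatic-parts : ∀ {H ρ} → 0 < n → H ⊆ L → length ρ ≡ n → R.Monochromatic labels n H ρ →
                        ∀ Y → Y ⊆ H → length Y ≡ length ρ → ∀ l → proj₁ 𝒜 (select ρ l Y)
  monochromatic-parts n>0 H⊆L ρ-length monochromatic Y Y⊆H Y-length l =
    subst (λ p → proj₁ 𝒜 (select p l Y)) (monochromatic Y Y⊆H (trans Y-length ρ-length))
      (select-labels∈𝒜 (admissible n>0 (⊆-trans Y⊆H H⊆L) (trans Y-length ρ-length)) l)

  g≥-exists : ∀ N → N + suc N ≤ n → ∃ λ S → Canonical S × g≥ 𝒜 h S N
  g≥-exists N N-small
    with proj₂ (R.ramsey n size) L (≤-reflexive (sym (length-applyUpTo _ _))) labels labels∈words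
  ... | H , ρ , H⊆L , H-big , _ , monochromatic =
    Homogeneous.g≥-exists 𝒜 (AllPairs-resp-⊆ H⊆L L-sorted) ρ
      (monochromatic-parts n>0 H⊆L ρ-length monochromatic)
      N (lookupOr-∈ zero ρ (subst (0 <_) (sym ρ-length) n>0)) (other-≢ _)
      (subst (λ k → suc k * k + k < length H) (sym ρ-length) H-big)
      (subst (N + suc N ≤_) (sym ρ-length) N-small)
    where
    n>0 : 0 < n
    n>0 = ≤-trans (s≤s z≤n) (≤-trans (m≤n+m (suc N) N) N-small)
    ρ-length : length ρ ≡ n
    ρ-length = monochromatic-length (≤-trans (≤-trans (m≤n+m n _) (n≤1+n _)) H-big) monochromatic

theorem4 : (h : ℕ) → h ≥ 2 → (𝒜 : Family) → (W : ℕ → Set) →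
    (∀ n → W n → n ≥ 1) → Infinite W →
    (∀ n → W n → CofinitelyRepresented 𝒜 h n) →
    ∀ n → ∃ λ (S : List ℕ) → Canonical S × g≥ 𝒜 h S n
theorem4 (suc (suc h')) (s≤s (s≤s z≤n)) 𝒜 W _ W-infinite W-represented N with W-infinite (N + suc N)
... | n , N-small , n∈W with W-represented n n∈W
... | E , represented = Cofinite.g≥-exists h' 𝒜 n E represented N N-small
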